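{- $pc(1,3)=1$, and for every integer $n>1$, $pc(n,3)=2\, f(n-1)$, where $f$ denotes the Fibonacci sequence with $f(1)=f(2)=1$ and $f(j+2)=f(j+1)+f(j)$.
   Context: A composition of a positive integer $n$ of length $k$ is a sequence $\sigma=(\sigma_1,\ldots,\sigma_k)$ of positive integers with $\sum_i \sigma_i=n$. For an integer $m\geq 1$, $\sigma$ is palindromic modulo $m$ if $\sigma_i\equiv\sigma_{k-i+1}\pmod m$ for all $1\le i\le k$. $pc(n,m)$ denotes the number of compositions of $n$ that are palindromic modulo $m$. -}

module Defs where

open import Data.Nat using (ℕ; zero; suc; _+_; _∸_; _<_; _%_; NonZero)
open import Data.Nat.Properties using (_≟_)
open import Data.List using (List; []; _∷_; length; map; concatMap; filter; lookup; upTo)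
open import Data.Nat.ListAction using (sum)
open import Data.Product using (_×_)
open import Data.List.Relation.Unary.All using (All)
open import Data.Fin using (Fin; toℕ; fromℕ<)
open import Data.Fin.Properties using (all?)
open import Relation.Binary.PropositionalEquality using (_≡_)
open import Relation.Nullary using (Dec)

fib : ℕ → ℕ
fib zero = zero
fib (suc zero) = suc zero
fib (suc (suc j)) = fib (suc j) + fib j

IsComposition : ℕ → List ℕ → Set
IsComposition n σ = All (λ x → 0 < x) σ × sum σ ≡ n

compositions : ℕ → List (List ℕ)
compositions n = go n n
  where
  -- go fuel n : compositions of n, fuel ≥ n ensures termination
  go : ℕ → ℕ → List (List ℕ)
  go _ zero = [] ∷ []
  go zero (suc _) = []
  go (suc fuel) (suc n) = concatMap (λ k → map (suc k ∷_) (go fuel (n ∸ k))) (upTo (suc n))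

-- σ (of length k) is palindromic modulo m: σ_i ≡ σ_{k-i+1} (mod m) for all i
-- (0-indexed: σ[i] % m ≡ σ[k-1-i] % m for all i < k).
revIdx : {k : ℕ} → Fin k → Fin k
revIdx {suc k} i = fromℕ< {k ∸ toℕ i} (Data.Nat.s≤s (Data.Nat.Properties.m∸n≤m k (toℕ i)))
  where import Data.Nat; import Data.Nat.Properties

PalindromicMod : (m : ℕ) .{{_ : NonZero m}} → List ℕ → Set
PalindromicMod m σ = (i : Fin (length σ)) → lookup σ i % m ≡ lookup σ (revIdx i) % m

palindromicMod? : (m : ℕ) .{{_ : NonZero m}} → (σ : List ℕ) → Dec (PalindromicMod m σ)
palindromicMod? m σ = all? (λ i → lookup σ i % m ≟ lookup σ (revIdx i) % m)

pc : ℕ → (m : ℕ) .{{_ : NonZero m}} → ℕ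
pc n m = length (filter (palindromicMod? m) (compositions n))

{-# OPTIONS --safe #-}
module Submission where

-- A composition of length at least two is palindromic modulo 3 exactly when its first and last
-- parts are congruent modulo 3 and the composition between them is palindromic modulo 3.
-- Classifying by the first part k + 1 and then by the last part j + 1 (the enumeration by last
-- part follows from the one by first part by transposing a triangular double sum) expresses
-- pc(n, 3) through the sums Y_k(s) = Σ_{j < s, j ≡ k (mod 3)} pc(s − 1 − j, 3).  These depend
-- on k only modulo 3 and satisfy Y_{k+1}(s + 1) = Y_k(s) + [k ≡ 2 (mod 3)] pc(s, 3);
-- eliminating them gives the Fibonacci recurrence pc(n + 5, 3) = pc(n + 4, 3) + pc(n + 3, 3),
-- and the initial values pc(n, 3) = 1, 2, 2, 4 for n = 1, …, 4 are computed.

open import Defs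
open import Data.Nat using (ℕ; zero; suc; _+_; _*_; _∸_; _≤_; _<_; _>_; _%_; s≤s; NonZero)
open import Data.Nat.Properties
open import Data.Nat.Induction using (<-rec)
open import Data.Nat.Tactic.RingSolver using (solve-∀)
open import Algebra.Properties.CommutativeSemigroup +-commutativeSemigroup using (interchange)
open import Data.Bool using (Bool; true; false; _∧_)
open import Data.List using (List; []; _∷_; _++_; [_]; _∷ʳ_; _ʳ++_; map; concat; concatMap; applyUpTo; upTo; length; filter; reverse; lookup)
open import Data.List.Properties using (map-++; map-cong; length-reverse; reverse-map; ∷-injective; ∷ʳ-injectiveˡ; unfold-reverse; reverse-++)
import Data.List.Properties as List
open import Data.List.Relation.Binary.Pointwise using (Pointwise; lookup⁻; lookup⁺; map⁺; map⁻; Pointwise-≡⇒≡; ≡⇒Pointwise-≡)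
open import Data.Fin using (Fin; toℕ)
open import Data.Fin.Properties using (toℕ-injective; toℕ-cast; toℕ-fromℕ<; toℕ<n)
open import Data.Product using (_×_; _,_)
open import Function using (_∘_; flip; _⇔_; mk⇔)
open import Relation.Nullary using (Dec; does)
open import Relation.Nullary.Decidable using (does-⇔; _×-dec_)
open import Relation.Unary using (Decidable)
open import Relation.Binary.PropositionalEquality using (_≡_; refl; sym; trans; cong; cong₂; subst; module ≡-Reasoning)

indicator : Bool → ℕ
indicator true = 1
indicator false = 0

count : {A : Set} → (A → Bool) → List A → ℕ
count p [] = 0
count p (x ∷ xs) = indicator (p x) + count p xs

module _ {A : Set} where

  length-filter≡count : {P : A → Set} (P? : Decidable P) (xs : List A) →
                        length (filter P? xs) ≡ count (does ∘ P?) xs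
  length-filter≡count P? [] = refl
  length-filter≡count P? (x ∷ xs) with does (P? x)
  ... | true = cong suc (length-filter≡count P? xs)
  ... | false = length-filter≡count P? xs

  count-cong : {p q : A → Bool} → (∀ x → p x ≡ q x) → ∀ xs → count p xs ≡ count q xs
  count-cong p≗q [] = refl
  count-cong p≗q (x ∷ xs) = cong₂ _+_ (cong indicator (p≗q x)) (count-cong p≗q xs)

  count-++ : ∀ (p : A → Bool) xs ys → count p (xs ++ ys) ≡ count p xs + count p ys
  count-++ p [] ys = refl
  count-++ p (x ∷ xs) ys = trans (cong (indicator (p x) +_) (count-++ p xs ys)) (sym (+-assoc (indicator (p x)) _ _))

  count-map : ∀ {B : Set} (p : B → Bool) (f : A → B) xs → count p (map f xs) ≡ count (p ∘ f) xs
  count-map p f [] = refl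
  count-map p f (x ∷ xs) = cong (indicator (p (f x)) +_) (count-map p f xs)

  count-∧ : ∀ b (p : A → Bool) xs → count (λ x → b ∧ p x) xs ≡ indicator b * count p xs
  count-∧ true p xs = sym (+-identityʳ (count p xs))
  count-∧ false p [] = refl
  count-∧ false p (x ∷ xs) = count-∧ false p xs

∑< : ℕ → (ℕ → ℕ) → ℕ
∑< zero f = 0
∑< (suc n) f = f 0 + ∑< n (f ∘ suc)

infix 9 ∑<
syntax ∑< n (λ k → e) = ∑[ k < n ] e

∑<-cong : ∀ n {f g : ℕ → ℕ} → (∀ k → f k ≡ g k) → ∑< n f ≡ ∑< n g
∑<-cong zero f≗g = refl
∑<-cong (suc n) f≗g = cong₂ _+_ (f≗g 0) (∑<-cong n (f≗g ∘ suc))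

∑<-+ : ∀ n (f g : ℕ → ℕ) → ∑[ k < n ] (f k + g k) ≡ ∑< n f + ∑< n g
∑<-+ zero f g = refl
∑<-+ (suc n) f g = trans (cong (f 0 + g 0 +_) (∑<-+ n (f ∘ suc) (g ∘ suc))) (interchange (f 0) (g 0) _ _)

count-concatMap-applyUpTo : ∀ {A : Set} (p : A → Bool) (F : ℕ → List A) (h : ℕ → ℕ) n →
                            count p (concatMap F (applyUpTo h n)) ≡ ∑[ k < n ] count p (F (h k))
count-concatMap-applyUpTo p F h zero = refl
count-concatMap-applyUpTo p F h (suc n) =
  trans (count-++ p (F (h 0)) _) (cong (count p (F (h 0)) +_) (count-concatMap-applyUpTo p F (h ∘ suc) n))

triangle : ℕ → (ℕ → ℕ → ℕ) → ℕ
triangle n F = ∑[ k < n ] ∑[ j < n ∸ suc k ] F k j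

triangle-transpose : ∀ n F → triangle n F ≡ triangle n (flip F)
triangle-transpose zero F = refl
triangle-transpose (suc zero) F = refl
triangle-transpose (suc (suc m)) F = begin
    (F 0 0 + ∑[ j < m ] F 0 (suc j)) + triangle (suc m) (λ k j → F (suc k) j)
  ≡⟨ cong (F 0 0 + ∑[ j < m ] F 0 (suc j) +_) (triangle-transpose (suc m) (F ∘ suc)) ⟩
    (F 0 0 + ∑[ j < m ] F 0 (suc j)) + (∑[ k < m ] F (suc k) 0 + triangle m (λ k j → F (suc j) (suc k)))
  ≡⟨ cong (λ t → (F 0 0 + ∑[ j < m ] F 0 (suc j)) + (∑[ k < m ] F (suc k) 0 + t)) (triangle-transpose m (λ k j → F (suc j) (suc k))) ⟩
    (F 0 0 + ∑[ j < m ] F 0 (suc j)) + (∑[ k < m ] F (suc k) 0 + triangle m (λ k j → F (suc k) (suc j)))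
  ≡⟨ interchange (F 0 0) (∑[ j < m ] F 0 (suc j)) (∑[ k < m ] F (suc k) 0) _ ⟩
    (F 0 0 + ∑[ k < m ] F (suc k) 0) + (∑[ j < m ] F 0 (suc j) + triangle m (λ k j → F (suc k) (suc j)))
  ≡⟨ cong (F 0 0 + ∑[ k < m ] F (suc k) 0 +_) (triangle-transpose (suc m) (λ k j → F k (suc j))) ⟩
    (F 0 0 + ∑[ k < m ] F (suc k) 0) + triangle (suc m) (λ k j → F j (suc k))
  ∎
  where open ≡-Reasoning

-- `compositions` keeps its fuelled enumeration in a where block.  The metavariables below are
-- solved by unification against its unfolding, which names it; abstracting n ∸ k turns the
-- second unification problem into a pattern.
mutual
  compositionsAfter : ℕ → ℕ → List (List ℕ)
  compositionsAfter = _

  compositions-unfold : ∀ n → compositions (suc n) ≡ concatMap (λ k → map (suc k ∷_) (compositionsAfter n k)) (upTo (suc n))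
  compositions-unfold n = refl

mutual
  fuelledCompositions : ℕ → ℕ → List (List ℕ)
  fuelledCompositions = _

  compositionsAfter-fuelled : ∀ n k → compositionsAfter n k ≡ fuelledCompositions n (n ∸ k)
  compositionsAfter-fuelled n k with n ∸ k
  ... | m = refl

fuelledCompositions-fuel : ∀ f f′ m → m ≤ f → m ≤ f′ → fuelledCompositions f m ≡ fuelledCompositions f′ m
fuelledCompositions-fuel f f′ zero _ _ = refl
fuelledCompositions-fuel (suc f) (suc f′) (suc m) (s≤s m≤f) (s≤s m≤f′) =
  cong concat (map-cong (λ k → cong (map (suc k ∷_)) (fuelledCompositions-fuel f f′ (m ∸ k)
    (≤-trans (m∸n≤m m k) m≤f) (≤-trans (m∸n≤m m k) m≤f′))) (upTo (suc m)))

compositions-suc : ∀ n → compositions (suc n) ≡ concatMap (λ k → map (suc k ∷_) (compositions (n ∸ k))) (upTo (suc n))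
compositions-suc n = trans (compositions-unfold n) (cong concat (map-cong (λ k → cong (map (suc k ∷_))
  (trans (compositionsAfter-fuelled n k) (fuelledCompositions-fuel n (n ∸ k) (n ∸ k) (m∸n≤m n k) ≤-refl))) (upTo (suc n))))

ifZero : ℕ → ℕ → ℕ
ifZero zero x = x
ifZero (suc _) x = 0

count-compositions-∷ : ∀ r (Q : List ℕ → Bool) → count Q (compositions r) ≡
  ifZero r (indicator (Q [])) + ∑[ k < r ] count (λ σ → Q (suc k ∷ σ)) (compositions (r ∸ suc k))
count-compositions-∷ zero Q = refl
count-compositions-∷ (suc n) Q = begin
    count Q (compositions (suc n))
  ≡⟨ cong (count Q) (compositions-suc n) ⟩
    count Q (concatMap (λ k → map (suc k ∷_) (compositions (n ∸ k))) (upTo (suc n)))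
  ≡⟨ count-concatMap-applyUpTo Q (λ k → map (suc k ∷_) (compositions (n ∸ k))) (λ k → k) (suc n) ⟩
    ∑[ k < suc n ] count Q (map (suc k ∷_) (compositions (n ∸ k)))
  ≡⟨ ∑<-cong (suc n) (λ k → count-map Q (suc k ∷_) (compositions (n ∸ k))) ⟩
    ∑[ k < suc n ] count (λ σ → Q (suc k ∷ σ)) (compositions (n ∸ k))
  ∎
  where open ≡-Reasoning

∸-swap : ∀ n a b → n ∸ a ∸ suc b ≡ n ∸ b ∸ suc a
∸-swap n a b = begin
  n ∸ a ∸ suc b   ≡⟨ ∸-+-assoc n a (suc b) ⟩
  n ∸ (a + suc b) ≡⟨ cong (n ∸_) (+-suc a b) ⟩
  n ∸ suc (a + b) ≡⟨ cong (λ c → n ∸ suc c) (+-comm a b) ⟩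
  n ∸ suc (b + a) ≡⟨ cong (n ∸_) (+-suc b a) ⟨
  n ∸ (b + suc a) ≡⟨ ∸-+-assoc n b (suc a) ⟨
  n ∸ b ∸ suc a   ∎
  where open ≡-Reasoning

count-compositions-∷ʳ : ∀ r (Q : List ℕ → Bool) → count Q (compositions r) ≡
  ifZero r (indicator (Q [])) + ∑[ j < r ] count (λ σ → Q (σ ∷ʳ suc j)) (compositions (r ∸ suc j))
count-compositions-∷ʳ = <-rec _ lastPart
  where
  LastPart : ℕ → Set
  LastPart r = ∀ Q → count Q (compositions r) ≡
    ifZero r (indicator (Q [])) + ∑[ j < r ] count (λ σ → Q (σ ∷ʳ suc j)) (compositions (r ∸ suc j))

  lastPart : ∀ r → (∀ {s} → s < r → LastPart s) → LastPart r
  lastPart zero _ Q = refl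
  lastPart (suc n) ih Q = begin
      count Q (compositions (suc n))
    ≡⟨ count-compositions-∷ (suc n) Q ⟩
      ∑[ k < suc n ] count (λ σ → Q (suc k ∷ σ)) (compositions (n ∸ k))
    ≡⟨ ∑<-cong (suc n) (λ k → ih (s≤s (m∸n≤m n k)) (λ σ → Q (suc k ∷ σ))) ⟩
      ∑[ k < suc n ] (ifZero (n ∸ k) (indicator (Q [ suc k ])) + ∑[ j < n ∸ k ] inner k j)
    ≡⟨ ∑<-+ (suc n) (λ k → ifZero (n ∸ k) (indicator (Q [ suc k ]))) (λ k → ∑[ j < n ∸ k ] inner k j) ⟩
      ∑[ k < suc n ] ifZero (n ∸ k) (indicator (Q [ suc k ])) + triangle (suc n) inner
    ≡⟨ cong (∑[ k < suc n ] ifZero (n ∸ k) (indicator (Q [ suc k ])) +_)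
         (trans (triangle-transpose (suc n) inner) (∑<-cong (suc n) (λ j → ∑<-cong (n ∸ j) (λ k → inner-swap j k)))) ⟩
      ∑[ j < suc n ] ifZero (n ∸ j) (indicator (Q [ suc j ])) + triangle (suc n) inner′
    ≡⟨ ∑<-+ (suc n) (λ j → ifZero (n ∸ j) (indicator (Q [ suc j ]))) (λ j → ∑[ k < n ∸ j ] inner′ j k) ⟨
      ∑[ j < suc n ] (ifZero (n ∸ j) (indicator (Q [ suc j ])) + ∑[ k < n ∸ j ] inner′ j k)
    ≡⟨ ∑<-cong (suc n) (λ j → count-compositions-∷ (n ∸ j) (λ σ → Q (σ ∷ʳ suc j))) ⟨
      ∑[ j < suc n ] count (λ σ → Q (σ ∷ʳ suc j)) (compositions (n ∸ j))
    ∎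
    where
    open ≡-Reasoning
    inner inner′ : ℕ → ℕ → ℕ
    inner k j = count (λ σ → Q (suc k ∷ σ ∷ʳ suc j)) (compositions (n ∸ k ∸ suc j))
    inner′ j k = count (λ σ → Q (suc k ∷ σ ∷ʳ suc j)) (compositions (n ∸ j ∸ suc k))
    inner-swap : ∀ j k → inner k j ≡ inner′ j k
    inner-swap j k = cong (λ s → count (λ σ → Q (suc k ∷ σ ∷ʳ suc j)) (compositions s)) (∸-swap n k j)

module _ {A : Set} where

  lookup-ʳ++ʳ : ∀ (xs ys : List A) {i : Fin (length (xs ʳ++ ys))} {j : Fin (length ys)} →
                toℕ i ≡ length xs + toℕ j → lookup (xs ʳ++ ys) i ≡ lookup ys j
  lookup-ʳ++ʳ [] ys eq = cong (lookup ys) (toℕ-injective eq)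
  lookup-ʳ++ʳ (x ∷ xs) ys {j = j} eq = lookup-ʳ++ʳ xs (x ∷ ys) {j = Fin.suc j} (trans eq (sym (+-suc (length xs) (toℕ j))))

  lookup-ʳ++ˡ : ∀ (xs ys : List A) {i : Fin (length (xs ʳ++ ys))} {j : Fin (length xs)} →
                toℕ i + suc (toℕ j) ≡ length xs → lookup (xs ʳ++ ys) i ≡ lookup xs j
  lookup-ʳ++ˡ (x ∷ xs) ys {i} {Fin.zero} eq =
    lookup-ʳ++ʳ xs (x ∷ ys) {j = Fin.zero} (trans (suc-injective (trans (+-comm 1 (toℕ i)) eq)) (sym (+-identityʳ (length xs))))
  lookup-ʳ++ˡ (x ∷ xs) ys {i} {Fin.suc j} eq =
    lookup-ʳ++ˡ xs (x ∷ ys) (suc-injective (trans (sym (+-suc (toℕ i) (suc (toℕ j)))) eq))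

  lookup-reverse : ∀ (xs : List A) {i : Fin (length (reverse xs))} {j : Fin (length xs)} →
                   toℕ i + suc (toℕ j) ≡ length xs → lookup (reverse xs) i ≡ lookup xs j
  lookup-reverse xs = lookup-ʳ++ˡ xs []

toℕ-revIdx : ∀ {n} (i : Fin n) → toℕ i + suc (toℕ (revIdx i)) ≡ n
toℕ-revIdx {suc n} i = begin
  toℕ i + suc (toℕ (revIdx i)) ≡⟨ cong (λ r → toℕ i + suc r) (toℕ-fromℕ< _) ⟩
  toℕ i + suc (n ∸ toℕ i)      ≡⟨ +-suc (toℕ i) (n ∸ toℕ i) ⟩
  suc (toℕ i + (n ∸ toℕ i))    ≡⟨ cong suc (m+[n∸m]≡n (≤-pred (toℕ<n i))) ⟩
  suc n                        ∎
  where open ≡-Reasoning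

Palindrome : {A : Set} → List A → Set
Palindrome xs = xs ≡ reverse xs

palindrome-map⇔ : ∀ {A B : Set} (f : A → B) (xs : List A) →
                  (∀ i → f (lookup xs i) ≡ f (lookup xs (revIdx i))) ⇔ Palindrome (map f xs)
palindrome-map⇔ f xs = mk⇔ to from
  where
  to : (∀ i → f (lookup xs i) ≡ f (lookup xs (revIdx i))) → Palindrome (map f xs)
  to mirror = trans (Pointwise-≡⇒≡ (map⁺ f f pointwise)) (reverse-map f xs)
    where
    pointwise : Pointwise (λ a b → f a ≡ f b) xs (reverse xs)
    pointwise = lookup⁻ (sym (length-reverse xs)) λ {i} {j} i≡j →
      trans (mirror i) (cong f (sym (lookup-reverse xs (subst (λ t → t + suc (toℕ (revIdx i)) ≡ length xs) i≡j (toℕ-revIdx i)))))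

  from : Palindrome (map f xs) → ∀ i → f (lookup xs i) ≡ f (lookup xs (revIdx i))
  from pal i = trans (lookup⁺ pointwise i)
    (cong f (lookup-reverse xs (subst (λ t → t + suc (toℕ (revIdx i)) ≡ length xs) (sym (toℕ-cast _ i)) (toℕ-revIdx i))))
    where
    pointwise : Pointwise (λ a b → f a ≡ f b) xs (reverse xs)
    pointwise = map⁻ f f (≡⇒Pointwise-≡ (trans pal (sym (reverse-map f xs))))

palindrome-∷-∷ʳ : ∀ {A : Set} (x y : A) xs → Palindrome (x ∷ (xs ∷ʳ y)) ⇔ (x ≡ y × Palindrome xs)
palindrome-∷-∷ʳ x y xs = mk⇔ to from
  where
  reverse-∷-∷ʳ : ∀ {A : Set} (x y : A) xs → reverse (x ∷ (xs ∷ʳ y)) ≡ y ∷ (reverse xs ∷ʳ x)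
  reverse-∷-∷ʳ x y xs = trans (unfold-reverse x (xs ∷ʳ y)) (cong (_∷ʳ x) (reverse-++ xs [ y ]))

  to : Palindrome (x ∷ (xs ∷ʳ y)) → x ≡ y × Palindrome xs
  to pal with ∷-injective (trans pal (reverse-∷-∷ʳ x y xs))
  ... | refl , xs∷ʳx≡ = refl , ∷ʳ-injectiveˡ xs (reverse xs) xs∷ʳx≡

  from : x ≡ y × Palindrome xs → Palindrome (x ∷ (xs ∷ʳ y))
  from (refl , pal) = trans (cong (λ ys → x ∷ (ys ∷ʳ x)) pal) (sym (reverse-∷-∷ʳ x x xs))

palindrome? : (xs : List ℕ) → Dec (Palindrome xs)
palindrome? xs = List.≡-dec _≟_ xs (reverse xs)

palindrome?-∷-∷ʳ : ∀ x y xs → does (palindrome? (x ∷ (xs ∷ʳ y))) ≡ does (x ≟ y) ∧ does (palindrome? xs)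
palindrome?-∷-∷ʳ x y xs = does-⇔ (palindrome-∷-∷ʳ x y xs) (palindrome? (x ∷ (xs ∷ʳ y))) ((x ≟ y) ×-dec palindrome? xs)

residuePalindromeᵇ : (m : ℕ) .{{_ : NonZero m}} → List ℕ → Bool
residuePalindromeᵇ m σ = does (palindrome? (map (_% m) σ))

residuePalindromeᵇ-∷-∷ʳ : ∀ m .{{_ : NonZero m}} a b σ →
  residuePalindromeᵇ m (a ∷ (σ ∷ʳ b)) ≡ does (a % m ≟ b % m) ∧ residuePalindromeᵇ m σ
residuePalindromeᵇ-∷-∷ʳ m a b σ =
  trans (cong (λ ys → does (palindrome? (a % m ∷ ys))) (map-++ (_% m) σ [ b ])) (palindrome?-∷-∷ʳ (a % m) (b % m) (map (_% m) σ))

pc≡count : ∀ n m .{{_ : NonZero m}} → pc n m ≡ count (residuePalindromeᵇ m) (compositions n)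
pc≡count n m = trans (length-filter≡count (palindromicMod? m) (compositions n))
  (count-cong (λ σ → does-⇔ (palindrome-map⇔ (_% m) σ) (palindromicMod? m σ) (palindrome? (map (_% m) σ))) (compositions n))

pcStartingWith : ℕ → ℕ → ℕ
pcStartingWith k s = count (λ σ → residuePalindromeᵇ 3 (suc k ∷ σ)) (compositions s)

congruentEndsSum : ℕ → ℕ → ℕ
congruentEndsSum k s = ∑[ j < s ] (indicator (does (suc k % 3 ≟ suc j % 3)) * pc (s ∸ suc j) 3)

pc-firstPart : ∀ n → pc (suc n) 3 ≡ ∑[ k < suc n ] pcStartingWith k (n ∸ k)
pc-firstPart n = trans (pc≡count (suc n) 3) (count-compositions-∷ (suc n) (residuePalindromeᵇ 3))

pcStartingWith-suc : ∀ k s → pcStartingWith k (suc s) ≡ congruentEndsSum k (suc s)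
pcStartingWith-suc k s = trans (count-compositions-∷ʳ (suc s) _) (∑<-cong (suc s) λ j → begin
    count (λ σ → residuePalindromeᵇ 3 (suc k ∷ (σ ∷ʳ suc j))) (compositions (s ∸ j))
  ≡⟨ count-cong (λ σ → residuePalindromeᵇ-∷-∷ʳ 3 (suc k) (suc j) σ) (compositions (s ∸ j)) ⟩
    count (λ σ → does (suc k % 3 ≟ suc j % 3) ∧ residuePalindromeᵇ 3 σ) (compositions (s ∸ j))
  ≡⟨ count-∧ (does (suc k % 3 ≟ suc j % 3)) (residuePalindromeᵇ 3) (compositions (s ∸ j)) ⟩
    indicator (does (suc k % 3 ≟ suc j % 3)) * count (residuePalindromeᵇ 3) (compositions (s ∸ j))
  ≡⟨ cong (indicator (does (suc k % 3 ≟ suc j % 3)) *_) (pc≡count (s ∸ j) 3) ⟨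
    indicator (does (suc k % 3 ≟ suc j % 3)) * pc (s ∸ j) 3
  ∎)
  where open ≡-Reasoning

sameResidue₃-suc : ∀ a b → does (suc a % 3 ≟ suc b % 3) ≡ does (a % 3 ≟ b % 3)
-- (3 + a) % 3 reduces to a % 3, which leaves nine closed cases.
sameResidue₃-suc (suc (suc (suc a))) b = sameResidue₃-suc a b
sameResidue₃-suc a (suc (suc (suc b))) = sameResidue₃-suc a b
sameResidue₃-suc 0 0 = refl
sameResidue₃-suc 0 1 = refl
sameResidue₃-suc 0 2 = refl
sameResidue₃-suc 1 0 = refl
sameResidue₃-suc 1 1 = refl
sameResidue₃-suc 1 2 = refl
sameResidue₃-suc 2 0 = refl
sameResidue₃-suc 2 1 = refl
sameResidue₃-suc 2 2 = refl

congruentEndsSum-suc : ∀ k s → congruentEndsSum (suc k) (suc s) ≡ indicator (does (suc (suc k) % 3 ≟ 1)) * pc s 3 + congruentEndsSum k s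
congruentEndsSum-suc k s = cong (indicator (does (suc (suc k) % 3 ≟ 1)) * pc s 3 +_)
  (∑<-cong s (λ j → cong (λ b → indicator b * pc (s ∸ suc j) 3) (sameResidue₃-suc (suc k) (suc j))))

pc-suc⁴ : ∀ n → pc (4 + n) 3 ≡ congruentEndsSum 0 (3 + n) + (congruentEndsSum 1 (2 + n) + (congruentEndsSum 2 (1 + n) + pc (1 + n) 3))
-- pcStartingWith (3 + k) is pcStartingWith k by computation, as (4 + k) % 3 reduces to
-- (1 + k) % 3; so the tail of the sum is pc-firstPart n read backwards.
pc-suc⁴ n = trans (pc-firstPart (3 + n))
  (cong₂ _+_ (pcStartingWith-suc 0 (2 + n)) (cong₂ _+_ (pcStartingWith-suc 1 (1 + n))
    (cong₂ _+_ (pcStartingWith-suc 2 n) (sym (pc-firstPart n)))))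

congruentEndsSum₀-suc : ∀ s → congruentEndsSum 0 (suc s) ≡ pc s 3 + congruentEndsSum 2 s
-- congruentEndsSum 3 and congruentEndsSum 0 agree by computation.
congruentEndsSum₀-suc s = trans (congruentEndsSum-suc 2 s) (cong (_+ congruentEndsSum 2 s) (*-identityˡ (pc s 3)))

pc-fibonacci : ∀ n → pc (5 + n) 3 ≡ pc (4 + n) 3 + pc (3 + n) 3
pc-fibonacci n = begin
    pc (5 + n) 3
  ≡⟨ pc-suc⁴ (1 + n) ⟩
    congruentEndsSum 0 (4 + n) + (congruentEndsSum 1 (3 + n) + (congruentEndsSum 2 (2 + n) + pc (2 + n) 3))
  ≡⟨ cong₂ _+_ (trans (congruentEndsSum₀-suc (3 + n)) (cong (pc (3 + n) 3 +_) (congruentEndsSum-suc 1 (2 + n))))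
               (cong (_+ (congruentEndsSum 2 (2 + n) + pc (2 + n) 3)) (trans (congruentEndsSum-suc 0 (2 + n)) (congruentEndsSum₀-suc (1 + n)))) ⟩
    (p₃ + y₂) + ((p₁ + y₃) + (y₁ + p₂))
  ≡⟨ rearrange p₁ p₂ p₃ y₁ y₂ y₃ ⟩
    ((p₂ + y₁) + (y₂ + (y₃ + p₁))) + p₃
  ≡⟨ cong (_+ p₃) (trans (pc-suc⁴ n) (cong (_+ (y₂ + (y₃ + p₁))) (congruentEndsSum₀-suc (2 + n)))) ⟨
    pc (4 + n) 3 + pc (3 + n) 3
  ∎
  where
  open ≡-Reasoning
  p₁ p₂ p₃ y₁ y₂ y₃ : ℕ
  p₁ = pc (1 + n) 3
  p₂ = pc (2 + n) 3
  p₃ = pc (3 + n) 3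
  y₁ = congruentEndsSum 2 (2 + n)
  y₂ = congruentEndsSum 1 (2 + n)
  y₃ = congruentEndsSum 2 (1 + n)
  rearrange : ∀ p₁ p₂ p₃ y₁ y₂ y₃ → (p₃ + y₂) + ((p₁ + y₃) + (y₁ + p₂)) ≡ ((p₂ + y₁) + (y₂ + (y₃ + p₁))) + p₃
  rearrange = solve-∀

pc-fib : ∀ s → pc (2 + s) 3 ≡ 2 * fib (1 + s)
pc-fib 0 = refl
pc-fib 1 = refl
pc-fib 2 = refl
pc-fib (suc (suc (suc t))) = begin
  pc (5 + t) 3                       ≡⟨ pc-fibonacci t ⟩
  pc (4 + t) 3 + pc (3 + t) 3        ≡⟨ cong₂ _+_ (pc-fib (suc (suc t))) (pc-fib (suc t)) ⟩
  2 * fib (3 + t) + 2 * fib (2 + t)  ≡⟨ *-distribˡ-+ 2 (fib (3 + t)) (fib (2 + t)) ⟨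
  2 * fib (4 + t)                    ∎
  where open ≡-Reasoning

mainTheorem2 : (pc 1 3 ≡ 1) × ((n : ℕ) → n > 1 → pc n 3 ≡ 2 * fib (n ∸ 1))
mainTheorem2 = refl , λ { (suc (suc s)) _ → pc-fib s ; (suc zero) (s≤s ()) }
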